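{- Let $G$ be an $n$-vertex totally ordered graph and let $x_0x_1$ be an edge of height $r$. If $s$ is a positive integer with $s\le n-2$, then $G$ contains a monotone path beginning $x_0x_1\ldots$ (i.e., extending $x_0x_1$) of length at least $sk+1$, where $$k=\left\lfloor \frac{r-1}{\binom{s+1}{2}+g(n,s)}\right\rfloor.$$
   Context: A totally ordered graph is a (finite) graph $G$ together with a total ordering $T(G)$ of $V(G)$ and a total ordering $T'(G)$ of $E(G)$. A monotone path is a path $x_0x_1\ldots x_k$ whose edges are increasing in $T'(G)$; its length is $k$. The height table of $G$ is an array $A$ with columns indexed by $V(G)$ and rows indexed by the positive integers; cell $A(i,u)$ precedes $A(i',u')$ iff $i<i'$, or $i=i'$ and $u$ precedes $u'$ in $T(G)$. The cells are filled in this order: $A(i,u)$ is the largest edge (in $T'(G)$) incident to $u$ not appearing in a preceding cell, and empty if none exists. The height $h_G(e)$ of an edge $e$ is the index of the row containing $e$. For $S\subseteq V(G)$, $G-S$ is the totally ordered graph obtained by deleting $S$, with orderings inherited from $G$. For an edge $e$ of $G-S$, $\mathrm{drop}(G,S,e)=h_G(e)-h_{G-S}(e)$. For $s\le n-2$, $g(n,s)$ is the maximum of $\mathrm{drop}(G,S,e)$ over all $n$-vertex totally ordered graphs $G$, all sets $S$ of $s$ vertices of $G$, and all edges $e\in E(G-S)$. -}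

module Defs where

open import Data.Nat using (ℕ; zero; suc; _+_; _*_; _∸_; _≤_; _<_; NonZero)
open import Data.Nat.Properties using (+-comm)
open import Data.Nat.DivMod using (_/_)
open import Data.Nat.Combinatorics using (_C_; nCk+nC[k+1]≡[n+1]C[k+1]; nC1≡n)
open import Data.Integer using (ℤ; _⊖_; _≤_; +_)
open import Data.Fin as Fin using (Fin)
open import Data.Product using (Σ; ∃; _×_; _,_; proj₁; proj₂)
open import Data.Product.Properties using (≡-dec)
open import Data.Sum using (_⊎_)
open import Data.Maybe using (Maybe; just; nothing)
open import Data.List using (List; []; _∷_; filter; last; length)
open import Data.List.Relation.Unary.All using (All)
open import Data.List.Relation.Unary.Any using (any?)
open import Data.List.Relation.Unary.Unique.Propositional using (Unique)
open import Data.List.Relation.Unary.Linked using (Linked)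
open import Data.List.Membership.Propositional using (_∈_; _∉_)
import Data.List.Membership.DecPropositional as DecMem
open import Data.Empty using (⊥)
open import Data.Unit using (⊤)
open import Relation.Binary.PropositionalEquality using (_≡_; refl; sym)
open import Relation.Binary.Definitions using (DecidableEquality)
open import Relation.Nullary using (¬_; yes; no)
open import Relation.Nullary.Decidable using (¬?; _⊎-dec_; _×-dec_)

-- The total order T(G) on V(G) is given by the
-- list `vord` (a duplicate-free enumeration of all vertices, earlier =
-- smaller).  Edges are unordered pairs {u,v}, u ≠ v, stored canonically as
-- (u , v) with u < v (in Fin); the total order T'(G) on E(G) is given by the
-- position in the duplicate-free list `edges` (earlier = smaller).

Edge : ℕ → Set
Edge n = Fin n × Fin n

record TOGraph (n : ℕ) : Set where
  field
    vord          : List (Fin n)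
    vord-unique   : Unique vord
    vord-complete : ∀ v → v ∈ vord
    edges         : List (Edge n)
    edges-unique  : Unique edges
    edges-canon   : All (λ e → proj₁ e Fin.< proj₂ e) edges

open TOGraph public

module _ {n : ℕ} where

  _≟E_ : DecidableEquality (Edge n)
  _≟E_ = ≡-dec Fin._≟_ Fin._≟_

  _∈V?_ : (v : Fin n) (S : List (Fin n)) → Relation.Nullary.Dec (v ∈ S)
  v ∈V? S = DecMem._∈?_ Fin._≟_ v S

  Incident : Fin n → Edge n → Set
  Incident u e = u ≡ proj₁ e ⊎ u ≡ proj₂ e

  -- the largest (= last in the increasing list) edge of `rem` incident to u
  largestInc : Fin n → List (Edge n) → Maybe (Edge n)
  largestInc u rem = last (filter (λ e → (u Fin.≟ proj₁ e) ⊎-dec (u Fin.≟ proj₂ e)) rem)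

  removeE : Edge n → List (Edge n) → List (Edge n)
  removeE e = filter (λ e′ → ¬? (e′ ≟E e))

  -- Fill one row of the height table: go through the vertices in the order
  -- T(G); the cell of u receives the largest not-yet-used edge incident to u
  -- (or stays empty).  Returns (edges in this row , edges still unused).
  fillRow : List (Fin n) → List (Edge n) → List (Edge n) × List (Edge n)
  fillRow [] rem = [] , rem
  fillRow (u ∷ us) rem with largestInc u rem
  ... | nothing = fillRow us rem
  ... | just e  with fillRow us (removeE e rem)
  ...   | row , rem′ = e ∷ row , rem′

  -- successive rows 1, 2, ... (fuel-bounded; `length es` rows suffice since
  -- every nonempty row uses at least one edge and, once a row is empty, all
  -- later rows are empty)
  rows : ℕ → List (Fin n) → List (Edge n) → List (List (Edge n))
  rows zero    vs rem = []
  rows (suc f) vs rem with fillRow vs rem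
  ... | row , rem′ = row ∷ rows f vs rem′

  heightTable : List (Fin n) → List (Edge n) → List (List (Edge n))
  heightTable vs es = rows (length es) vs es

  -- 1-based index of the row containing e (0 if e occurs in no row)
  rowIndex : List (List (Edge n)) → Edge n → ℕ
  rowIndex [] e = 0
  rowIndex (r ∷ rs) e with any? (e ≟E_) r | rowIndex rs e
  ... | yes _ | _ = 1
  ... | no _  | zero = 0
  ... | no _  | suc i = suc (suc i)

  heightRaw : List (Fin n) → List (Edge n) → Edge n → ℕ
  heightRaw vs es e = rowIndex (heightTable vs es) e

  height : TOGraph n → Edge n → ℕ
  height G e = heightRaw (vord G) (edges G) e

  delVerts : TOGraph n → List (Fin n) → List (Fin n)
  delVerts G S = filter (λ v → ¬? (v ∈V? S)) (vord G)

  delEdges : TOGraph n → List (Fin n) → List (Edge n)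
  delEdges G S = filter (λ e → ¬? (proj₁ e ∈V? S) ×-dec ¬? (proj₂ e ∈V? S)) (edges G)

  heightDel : TOGraph n → List (Fin n) → Edge n → ℕ
  heightDel G S e = heightRaw (delVerts G S) (delEdges G S) e

  drop : TOGraph n → List (Fin n) → Edge n → ℤ
  drop G S e = height G e ⊖ heightDel G S e

  -- At xs i a : the i-th (0-based) entry of xs is a
  At : {A : Set} → List A → ℕ → A → Set
  At [] i a = ⊥
  At (x ∷ xs) zero a = x ≡ a
  At (x ∷ xs) (suc i) a = At xs i a

  EdgeAt : List (Edge n) → Fin n → Fin n → ℕ → Set
  EdgeAt es u v i = At es i (u , v) ⊎ At es i (v , u)

  -- Chain es p is : consecutive vertices of p are joined by the edges whose
  -- positions in the edge order are listed in `is`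
  Chain : List (Edge n) → List (Fin n) → List ℕ → Set
  Chain es [] is = ⊥
  Chain es (u ∷ []) [] = ⊤
  Chain es (u ∷ []) (i ∷ is) = ⊥
  Chain es (u ∷ v ∷ p) [] = ⊥
  Chain es (u ∷ v ∷ p) (i ∷ is) = EdgeAt es u v i × Chain es (v ∷ p) is

  MonotonePath : TOGraph n → List (Fin n) → ℕ → Set
  MonotonePath G p ℓ =
    Unique p × Σ (List ℕ) λ is → Chain (edges G) p is × Linked _<_ is × length is ≡ ℓ

IsGMax : (n s : ℕ) → ℕ → Set
IsGMax n s g =
  (∀ (G : TOGraph n) (S : List (Fin n)) → Unique S → length S ≡ s →
     ∀ e → e ∈ delEdges G S → drop G S e Data.Integer.≤ + g)
  × (Σ (TOGraph n) λ G → Σ (List (Fin n)) λ S → Unique S × length S ≡ s ×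
       Σ (Edge n) λ e → e ∈ delEdges G S × drop G S e ≡ + g)

-- k = ⌊ (r − 1) / (C(s+1,2) + g) ⌋  (only used for s ≥ 1, where the
-- denominator is nonzero)

denom-nz : ∀ s g → NonZero ((suc s + 1) C 2 + g)
denom-nz s g rewrite +-comm s 1
                   | sym (nCk+nC[k+1]≡[n+1]C[k+1] (suc s) 1)
                   | nC1≡n (suc s) = _

kVal : (r s g : ℕ) → ℕ
kVal r zero g = 0
kVal r (suc s) g = ((r ∸ 1) / ((suc s + 1) C 2 + g)) {{denom-nz s g}}

module Submission where

-- Write D = C(s+1,2) + g.  If an
-- edge e = xy of height h is preceded on the path by a set F of t vertices,
-- then below h the vertex y carries, for every height i < h, a later edge of
-- height exactly i (lower-heights).  Taking the t + 1 heights just above a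
-- threshold b gives t + 1 later edges at y with distinct other ends, so one of
-- them, yw, has w ∉ F (escape, a pigeonhole); its height is still > b (greedyStep).
-- Repeating this s times costs 1 + 2 + … + s = C(s+1,2) in height
-- (segment).  Then the s vertices used are deleted: by definition of
-- g = g(n,s) the current edge loses at most g in height (afterDeletion), and
-- the deleted vertices cannot reappear later on the path.  So each round of s
-- steps costs at most D in height, and induction on k (reach) yields a path of
-- s·k + 1 edges.

open import Defs
open import Data.Nat using (ℕ; zero; suc; _+_; _*_; _∸_; _≤_; _<_; z≤n; s≤s)
open import Data.Nat.Properties
open import Data.Nat.DivMod using (m/n*n≤m)
open import Data.Nat.Combinatorics using (_C_; nCk+nC[k+1]≡[n+1]C[k+1]; nC1≡n)
import Data.Integer as ℤ
import Data.Integer.Properties as ℤ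
open import Data.Fin using (Fin; toℕ)
import Data.Fin as Fin
import Data.Fin.Properties as Fin
open import Data.Product using (Σ; ∃; _×_; _,_; proj₁; proj₂; map; map₁)
open import Data.Sum using (_⊎_; inj₁; inj₂)
import Data.Sum as Sum
open import Data.Unit using (tt)
open import Data.Empty using (⊥-elim)
open import Data.Maybe using (just; nothing)
open import Data.List using (List; []; _∷_; filter; last; length)
import Data.List as List
open import Data.List.Properties using (filter-none)
open import Data.List.Relation.Unary.All using (All; []; _∷_)
import Data.List.Relation.Unary.All as All
open import Data.List.Relation.Unary.All.Properties using (¬Any⇒All¬)
open import Data.List.Relation.Unary.Any using (here; there; index; any?)
open import Data.List.Relation.Unary.Any.Properties using (lookup-index)
open import Data.List.Relation.Unary.AllPairs using ([]; _∷_)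
open import Data.List.Relation.Unary.Unique.Propositional using (Unique)
open import Data.List.Relation.Unary.Linked using (Linked; [-]; _∷_)
open import Data.List.Relation.Binary.Sublist.Propositional as Sublist using (_⊆_; _∷ʳ_; ⊆-refl; ⊆-trans)
open import Data.List.Relation.Binary.Sublist.Propositional.Properties using (All-resp-⊆; filter-⊆)
open import Data.List.Membership.Propositional using (_∈_; _∉_)
open import Data.List.Membership.Propositional.Properties using (∈-filter⁺; ∈-filter⁻)
open import Relation.Binary.PropositionalEquality
open import Relation.Binary.Definitions using (DecidableEquality)
open import Relation.Nullary using (¬_; yes; no; Dec)
open import Relation.Nullary.Decidable using (¬?; _⊎-dec_)
open import Relation.Unary using (Decidable)
open import Function using (id)

-- Order of occurrence in a list

module _ {A : Set} where

  -- Precedes xs a b : an occurrence of a in xs lies strictly before an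
  -- occurrence of b.  In an edge list this is the order T′ ("a is smaller").
  data Precedes : List A → A → A → Set where
    at-head : ∀ {a b xs} → b ∈ xs → Precedes (a ∷ xs) a b
    in-tail : ∀ {x a b xs} → Precedes xs a b → Precedes (x ∷ xs) a b

  Precedes-resp-⊆ : ∀ {xs ys a b} → xs ⊆ ys → Precedes xs a b → Precedes ys a b
  Precedes-resp-⊆ (_ ∷ʳ τ)           pr           = in-tail (Precedes-resp-⊆ τ pr)
  Precedes-resp-⊆ (refl Sublist.∷ τ) (at-head m)  = at-head (Sublist.lookup τ m)
  Precedes-resp-⊆ (refl Sublist.∷ τ) (in-tail pr) = in-tail (Precedes-resp-⊆ τ pr)

  Precedes-irrefl : ∀ {xs a} → Unique xs → ¬ Precedes xs a a
  Precedes-irrefl (a∉ ∷ _) (at-head m)  = All.lookup a∉ m refl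
  Precedes-irrefl (_ ∷ u)  (in-tail pr) = Precedes-irrefl u pr

  Precedes-∈ˡ : ∀ {xs a b} → Precedes xs a b → a ∈ xs
  Precedes-∈ˡ (at-head _)  = here refl
  Precedes-∈ˡ (in-tail pr) = there (Precedes-∈ˡ pr)

  Unique-resp-⊆ : ∀ {xs ys : List A} → xs ⊆ ys → Unique ys → Unique xs
  Unique-resp-⊆ Sublist.[]          []        = []
  Unique-resp-⊆ (_ ∷ʳ τ)           (_ ∷ u)   = Unique-resp-⊆ τ u
  Unique-resp-⊆ (refl Sublist.∷ τ) (y∉ ∷ u)  = All-resp-⊆ τ y∉ ∷ Unique-resp-⊆ τ u

  last-∈ : ∀ (xs : List A) {f} → last xs ≡ just f → f ∈ xs
  last-∈ (x ∷ [])     refl = here refl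
  last-∈ (x ∷ y ∷ ys) eq   = there (last-∈ (y ∷ ys) eq)

  last-latest : ∀ (xs : List A) {e f} → last xs ≡ just f → e ∈ xs → f ≡ e ⊎ Precedes xs e f
  last-latest (x ∷ [])     refl (here refl) = inj₁ refl
  last-latest (x ∷ y ∷ ys) eq   (here refl) = inj₂ (at-head (last-∈ (y ∷ ys) eq))
  last-latest (x ∷ y ∷ ys) eq   (there m)   = Sum.map₂ in-tail (last-latest (y ∷ ys) eq m)

  last-empty : ∀ (xs : List A) {e} → last xs ≡ nothing → e ∉ xs
  last-empty (x ∷ y ∷ ys) eq _ = last-empty (y ∷ ys) eq (here refl)

module _ {n : ℕ} where

  AtEdge : List (Edge n) → ℕ → Edge n → Set
  AtEdge = At {n = n}

  ∈⇒AtEdge : ∀ {es e} → e ∈ es → ∃ λ i → AtEdge es i e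
  ∈⇒AtEdge (here refl) = 0 , refl
  ∈⇒AtEdge (there m)   = map suc id (∈⇒AtEdge m)

  AtEdge⇒∈ : ∀ es {i e} → AtEdge es i e → e ∈ es
  AtEdge⇒∈ (x ∷ es) {zero}  refl = here refl
  AtEdge⇒∈ (x ∷ es) {suc i} a    = there (AtEdge⇒∈ es a)

  later-position : ∀ es {p e f} → Unique es → AtEdge es p e → Precedes es e f →
                   ∃ λ j → p < j × AtEdge es j f
  later-position (x ∷ es) {zero}  _         refl (at-head f∈) =
    map suc (s≤s z≤n ,_) (∈⇒AtEdge f∈)
  later-position (x ∷ es) {zero}  (x∉ ∷ _)  refl (in-tail pr) =
    ⊥-elim (All.lookup x∉ (Precedes-∈ˡ pr) refl)
  later-position (x ∷ es) {suc p} (x∉ ∷ _)  a    (at-head _)  =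
    ⊥-elim (All.lookup x∉ (AtEdge⇒∈ es a) refl)
  later-position (x ∷ es) {suc p} (_ ∷ u)   a    (in-tail pr) =
    map suc (map₁ s≤s) (later-position es u a pr)

-- The height table, row by row

module _ {n : ℕ} where

  open import Data.List.Membership.DecPropositional (_≟E_ {n = n}) using (_∈?_)

  incident? : (u : Fin n) → Decidable (Incident u)
  incident? u e = (u Fin.≟ proj₁ e) ⊎-dec (u Fin.≟ proj₂ e)

  largestInc-just : ∀ u rem {f} → largestInc u rem ≡ just f →
    f ∈ rem × Incident u f × (∀ {e} → e ∈ rem → Incident u e → f ≡ e ⊎ Precedes rem e f)
  largestInc-just u rem {f} eq = proj₁ member , proj₂ member , latest
    where
    atU = filter (incident? u) rem
    member : f ∈ rem × Incident u f
    member = ∈-filter⁻ (incident? u) {xs = rem} (last-∈ atU eq)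
    latest : ∀ {e} → e ∈ rem → Incident u e → f ≡ e ⊎ Precedes rem e f
    latest e∈ u∼e = Sum.map₂ (Precedes-resp-⊆ (filter-⊆ (incident? u) rem))
      (last-latest atU eq (∈-filter⁺ (incident? u) e∈ u∼e))

  largestInc-nothing : ∀ u rem {e} → largestInc u rem ≡ nothing → e ∈ rem → ¬ Incident u e
  largestInc-nothing u rem eq e∈ u∼e =
    last-empty (filter (incident? u) rem) eq (∈-filter⁺ (incident? u) e∈ u∼e)

  largestInc-isolated : ∀ u rem → (∀ {e} → e ∈ rem → ¬ Incident u e) → largestInc u rem ≡ nothing
  largestInc-isolated u rem isolated
    rewrite filter-none (incident? u) (All.tabulate {xs = rem} isolated) = refl

  removeE-⊆ : ∀ (e : Edge n) rem → removeE e rem ⊆ rem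
  removeE-⊆ e = filter-⊆ (λ e′ → ¬? (e′ ≟E e))

  ∈-removeE⁺ : ∀ {e x : Edge n} {rem} → x ∈ rem → x ≢ e → x ∈ removeE e rem
  ∈-removeE⁺ {e} = ∈-filter⁺ (λ e′ → ¬? (e′ ≟E e))

  ∈-removeE⁻ : ∀ {e x : Edge n} rem → x ∈ removeE e rem → x ≢ e
  ∈-removeE⁻ {e} rem x∈ = proj₂ (∈-filter⁻ (λ e′ → ¬? (e′ ≟E e)) {xs = rem} x∈)

  record RowSplit (rem row rem′ : List (Edge n)) : Set where
    field
      row⊆rem  : ∀ {x} → x ∈ row → x ∈ rem
      left⊆rem : rem′ ⊆ rem
      disjoint : ∀ {x} → x ∈ rem′ → x ∉ row
      complete : ∀ {x} → x ∈ rem → x ∉ row → x ∈ rem′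

  fillRow-split : ∀ vs rem {row rem′} → fillRow vs rem ≡ (row , rem′) → RowSplit rem row rem′
  fillRow-split [] rem refl = record
    { row⊆rem = λ () ; left⊆rem = ⊆-refl ; disjoint = λ _ () ; complete = λ x∈ _ → x∈ }
  fillRow-split (u ∷ us) rem eq with largestInc u rem in eqL
  ... | nothing = fillRow-split us rem eq
  ... | just f with fillRow us (removeE f rem) in eqR
  fillRow-split (u ∷ us) rem refl | just f | row , rem′ = record
    { row⊆rem  = λ { (here refl) → proj₁ (largestInc-just u rem eqL)
                   ; (there x∈) → Sublist.lookup (removeE-⊆ f rem) (row⊆rem x∈) }
    ; left⊆rem = ⊆-trans left⊆rem (removeE-⊆ f rem)
    ; disjoint = λ { x∈ (here refl) → ∈-removeE⁻ rem (Sublist.lookup left⊆rem x∈) refl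
                   ; x∈ (there x∈row) → disjoint x∈ x∈row }
    ; complete = λ x∈ x∉ → complete (∈-removeE⁺ x∈ (λ x≡f → x∉ (here x≡f))) (λ x∈row → x∉ (there x∈row)) }
    where open RowSplit (fillRow-split us (removeE f rem) eqR)

  fillRow-covers : ∀ vs rem {row rem′} → fillRow vs rem ≡ (row , rem′) →
    ∀ {v e} → v ∈ vs → e ∈ rem → Incident v e →
    ∃ λ f → f ∈ row × Incident v f × (f ≡ e ⊎ Precedes rem e f)
  fillRow-covers (u ∷ us) rem eq v∈ e∈ v∼e with largestInc u rem in eqL
  fillRow-covers (u ∷ us) rem eq (here refl) e∈ v∼e | nothing =
    ⊥-elim (largestInc-nothing u rem eqL e∈ v∼e)
  fillRow-covers (u ∷ us) rem eq (there v∈) e∈ v∼e | nothing = fillRow-covers us rem eq v∈ e∈ v∼e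
  ... | just f with fillRow us (removeE f rem) in eqR
  fillRow-covers (u ∷ us) rem refl (here refl) e∈ v∼e | just f | _ =
    let (_ , u∼f , latest) = largestInc-just u rem eqL in f , here refl , u∼f , latest e∈ v∼e
  fillRow-covers (u ∷ us) rem refl {e = e} (there v∈) e∈ v∼e | just f | _ with e ≟E f
  ... | yes refl = f , here refl , v∼e , inj₁ refl
  ... | no e≢f with fillRow-covers us (removeE f rem) eqR v∈ (∈-removeE⁺ e∈ e≢f) v∼e
  ...   | f′ , f′∈ , v∼f′ , later = f′ , there f′∈ , v∼f′ , Sum.map₂ (Precedes-resp-⊆ (removeE-⊆ f rem)) later

  -- rowIndex after prepending a row that misses e: one more than before,
  -- while 0 ("e is in no row") stays 0.
  shiftIndex : ℕ → ℕ
  shiftIndex zero    = zero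
  shiftIndex (suc i) = suc (suc i)

  shiftIndex-< : ∀ {i h} → suc i < shiftIndex h → i < h
  shiftIndex-< {h = suc h} (s≤s i<h) = i<h

  rowIndex-hit : ∀ (row : List (Edge n)) rows {e} → e ∈ row → rowIndex (row ∷ rows) e ≡ 1
  rowIndex-hit row rows {e} e∈ with any? (e ≟E_) row | rowIndex rows e
  ... | yes _  | _ = refl
  ... | no e∉  | _ = ⊥-elim (e∉ e∈)

  rowIndex-miss : ∀ (row : List (Edge n)) rows {e} → e ∉ row →
                  rowIndex (row ∷ rows) e ≡ shiftIndex (rowIndex rows e)
  rowIndex-miss row rows {e} e∉ with any? (e ≟E_) row | rowIndex rows e
  ... | yes e∈ | _     = ⊥-elim (e∉ e∈)
  ... | no _   | zero  = refl
  ... | no _   | suc i = refl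

  -- Every height below that of an edge e at v is attained by an edge at v
  -- that follows e: if e lands in row h, then in each earlier row i the
  -- cell of v was filled with an edge at least as large as e.
  lower-heights : ∀ fuel (vs : List (Fin n)) rem {e v} → v ∈ vs → e ∈ rem → Incident v e →
    ∀ i → 1 ≤ i → i < rowIndex (rows fuel vs rem) e →
    ∃ λ f → f ∈ rem × Incident v f × Precedes rem e f × rowIndex (rows fuel vs rem) f ≡ i
  lower-heights (suc fuel) vs rem {e} {v} v∈ e∈ v∼e i 1≤i i<h with fillRow vs rem in eq
  ... | row , rem′ = first-row (e ∈? row) i 1≤i i<h
    where
    open RowSplit (fillRow-split vs rem eq)
    later = rows fuel vs rem′
    first-row : Dec (e ∈ row) → ∀ i → 1 ≤ i → i < rowIndex (row ∷ later) e →
      ∃ λ f → f ∈ rem × Incident v f × Precedes rem e f × rowIndex (row ∷ later) f ≡ i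
    first-row (yes e∈row) i 1≤i i<h rewrite rowIndex-hit row later e∈row = ⊥-elim (<⇒≱ i<h 1≤i)
    first-row (no e∉row) (suc zero) _ _ with fillRow-covers vs rem eq v∈ e∈ v∼e
    ... | f , f∈row , v∼f , inj₁ refl = ⊥-elim (e∉row f∈row)
    ... | f , f∈row , v∼f , inj₂ e≺f = f , row⊆rem f∈row , v∼f , e≺f , rowIndex-hit row later f∈row
    first-row (no e∉row) (suc (suc i)) _ i<h
      with lower-heights fuel vs rem′ v∈ (complete e∈ e∉row) v∼e (suc i) (s≤s z≤n)
             (shiftIndex-< (subst (suc (suc i) <_) (rowIndex-miss row later e∉row) i<h))
    ... | f , f∈ , v∼f , e≺f , f-row =
      f , Sublist.lookup left⊆rem f∈ , v∼f , Precedes-resp-⊆ left⊆rem e≺f ,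
      trans (rowIndex-miss row later (disjoint f∈)) (cong shiftIndex f-row)

  Isolated : List (Fin n) → List (Edge n) → Set
  Isolated S rem = ∀ {u e} → u ∈ S → e ∈ rem → ¬ Incident u e

  -- Deleting vertices that carry no remaining edge does not change the rows:
  -- their cells would stay empty anyway.
  fillRow-skip-isolated : ∀ S vs rem → Isolated S rem →
    fillRow (filter (λ v → ¬? (v ∈V? S)) vs) rem ≡ fillRow vs rem
  fillRow-skip-isolated S [] rem isolated = refl
  fillRow-skip-isolated S (u ∷ us) rem isolated with u ∈V? S
  ... | yes u∈S rewrite largestInc-isolated u rem (isolated u∈S) = fillRow-skip-isolated S us rem isolated
  ... | no _ with largestInc u rem
  ...   | nothing = fillRow-skip-isolated S us rem isolated
  ...   | just f rewrite fillRow-skip-isolated S us (removeE f rem)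
                           (λ u∈S f′∈ → isolated u∈S (Sublist.lookup (removeE-⊆ f rem) f′∈)) = refl

  rows-skip-isolated : ∀ S fuel vs rem → Isolated S rem →
    rows fuel (filter (λ v → ¬? (v ∈V? S)) vs) rem ≡ rows fuel vs rem
  rows-skip-isolated S zero vs rem isolated = refl
  rows-skip-isolated S (suc fuel) vs rem isolated
    rewrite fillRow-skip-isolated S vs rem isolated with fillRow vs rem in eq
  ... | row , rem′ = cong (row ∷_) (rows-skip-isolated S fuel vs rem′
        (λ u∈S e∈ → isolated u∈S (Sublist.lookup (RowSplit.left⊆rem (fillRow-split vs rem eq)) e∈)))

-- Arithmetic

-- rangeSum t m = (t + 1) + (t + 2) + ⋯ + (t + m): the height spent by the
-- greedy steps t + 1, …, t + m of a round.
rangeSum : ℕ → ℕ → ℕ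
rangeSum t zero    = zero
rangeSum t (suc m) = suc t + rangeSum (suc t) m

rangeSum-C : ∀ t m → rangeSum t m + (t + 1) C 2 ≡ (t + m + 1) C 2
rangeSum-C t zero = cong (λ z → (z + 1) C 2) (sym (+-identityʳ t))
rangeSum-C t (suc m) = begin
  suc t + rangeSum (suc t) m + (t + 1) C 2     ≡⟨ cong (_+ (t + 1) C 2) (+-comm (suc t) _) ⟩
  rangeSum (suc t) m + suc t + (t + 1) C 2     ≡⟨ +-assoc (rangeSum (suc t) m) (suc t) _ ⟩
  rangeSum (suc t) m + (suc t + (t + 1) C 2)   ≡⟨ cong (λ z → rangeSum (suc t) m + (z + (t + 1) C 2)) suc-t≡C ⟩
  rangeSum (suc t) m + ((t + 1) C 1 + (t + 1) C 2) ≡⟨ cong (rangeSum (suc t) m +_) (nCk+nC[k+1]≡[n+1]C[k+1] (t + 1) 1) ⟩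
  rangeSum (suc t) m + (suc t + 1) C 2         ≡⟨ rangeSum-C (suc t) m ⟩
  (suc t + m + 1) C 2                          ≡⟨ cong (λ z → (z + 1) C 2) (sym (+-suc t m)) ⟩
  (t + suc m + 1) C 2                          ∎
  where
  open ≡-Reasoning
  suc-t≡C : suc t ≡ (t + 1) C 1
  suc-t≡C = trans (+-comm 1 t) (sym (nC1≡n (t + 1)))

rangeSum-pos : ∀ t {m} → 1 ≤ m → 1 ≤ rangeSum t m
rangeSum-pos t {suc m} _ = s≤s z≤n

rangeSum-round : ∀ s → rangeSum 0 s ≡ (s + 1) C 2
rangeSum-round s = trans (sym (+-identityʳ (rangeSum 0 s))) (rangeSum-C 0 s)

drop-bound : ∀ m n g → m ℤ.⊖ n ℤ.≤ ℤ.+ g → m ≤ n + g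
drop-bound m n g m⊖n≤g with n ≤? m
... | no n≰m = ≤-trans (<⇒≤ (≰⇒> n≰m)) (m≤m+n n g)
... | yes n≤m with subst (ℤ._≤ ℤ.+ g) (ℤ.⊖-≥ n≤m) m⊖n≤g
...   | ℤ.+≤+ m∸n≤g = begin
  m           ≡⟨ sym (m∸n+n≡m n≤m) ⟩
  m ∸ n + n   ≤⟨ +-monoˡ-≤ n m∸n≤g ⟩
  g + n       ≡⟨ +-comm g n ⟩
  n + g       ∎
  where open ≤-Reasoning

<-of-≤∸1 : ∀ {a h} → 1 ≤ a → a ≤ h ∸ 1 → a < h
<-of-≤∸1 {h = zero}  (s≤s _) ()
<-of-≤∸1 {h = suc h} _       a≤h = s≤s a≤h

≤∸1-of-< : ∀ {a h} → a < h → a ≤ h ∸ 1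
≤∸1-of-< (s≤s a≤h) = a≤h

escape : ∀ {A : Set} → DecidableEquality A → ∀ {t} (F : List A) → length F ≡ t →
         (c : Fin (suc t) → A) → (∀ {a b} → c a ≡ c b → a ≡ b) → ∃ λ u → c u ∉ F
escape {A} _≟_ {t} F |F|≡t c c-injective =
  Fin.¬∀⟶∃¬ (suc t) (λ u → c u ∈ F) (λ u → c u ∈? F) not-all
  where
  open import Data.List.Membership.DecPropositional _≟_ using (_∈?_)
  not-all : ¬ (∀ u → c u ∈ F)
  not-all all-in with Fin.pigeonhole (s≤s (≤-reflexive |F|≡t)) (λ u → index (all-in u))
  ... | i , j , i<j , same-slot = Fin.<-irrefl (c-injective c-i≡c-j) i<j
    where
    c-i≡c-j : c i ≡ c j
    c-i≡c-j = trans (lookup-index (all-in i))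
                (trans (cong (List.lookup F) same-slot) (sym (lookup-index (all-in j))))

-- Edges as unordered pairs

module _ {n : ℕ} where

  Joins : Edge n → Fin n → Fin n → Set
  Joins e a b = e ≡ (a , b) ⊎ e ≡ (b , a)

  Canonical : Edge n → Set
  Canonical e = proj₁ e Fin.< proj₂ e

  joins-sym : ∀ {e a b} → Joins e a b → Joins e b a
  joins-sym = Sum.swap

  joins-incidentˡ : ∀ {e a b} → Joins e a b → Incident a e
  joins-incidentˡ (inj₁ refl) = inj₁ refl
  joins-incidentˡ (inj₂ refl) = inj₂ refl

  joins-incidentʳ : ∀ {e a b} → Joins e a b → Incident b e
  joins-incidentʳ j = joins-incidentˡ (joins-sym j)

  incident-joins : ∀ {v e} → Incident v e → ∃ λ w → Joins e v w
  incident-joins {e = a , b} (inj₁ refl) = b , inj₁ refl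
  incident-joins {e = a , b} (inj₂ refl) = a , inj₂ refl

  joins-irrefl : ∀ {e a} → Canonical e → ¬ Joins e a a
  joins-irrefl c (inj₁ refl) = Fin.<-irrefl refl c
  joins-irrefl c (inj₂ refl) = Fin.<-irrefl refl c

  joins-unique : ∀ {e e′ a b} → Canonical e → Canonical e′ → Joins e a b → Joins e′ a b → e ≡ e′
  joins-unique _ _  (inj₁ refl) (inj₁ refl) = refl
  joins-unique _ _  (inj₂ refl) (inj₂ refl) = refl
  joins-unique c c′ (inj₁ refl) (inj₂ refl) = ⊥-elim (Fin.<-asym c c′)
  joins-unique c c′ (inj₂ refl) (inj₁ refl) = ⊥-elim (Fin.<-asym c c′)

  edgeAt : ∀ es {i e a b} → AtEdge es i e → Joins e a b → EdgeAt es a b i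
  edgeAt es a (inj₁ refl) = inj₁ a
  edgeAt es a (inj₂ refl) = inj₂ a

-- g bounds every drop caused by deleting s vertices from an n-vertex graph
-- (the first half of IsGMax n s g; the construction needs nothing more).
DropBound : ℕ → ℕ → ℕ → Set
DropBound n s g =
  ∀ (G : TOGraph n) (S : List (Fin n)) → Unique S → length S ≡ s →
    ∀ e → e ∈ delEdges G S → drop G S e ℤ.≤ ℤ.+ g

-- The greedy construction in a fixed graph G, for fixed s ≥ 1 and g.  The
-- subgraphs met along the way keep all vertices of G and a sublist es of its
-- edges; their heights are ht es.
module Construction {n : ℕ} (G : TOGraph n) (s g : ℕ) (1≤s : 1 ≤ s) (bounded : DropBound n s g) where

  EG : List (Edge n)
  EG = edges G

  -- the height lost by one round: s greedy steps and one deletion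
  D : ℕ
  D = (s + 1) C 2 + g

  ht : List (Edge n) → Edge n → ℕ
  ht es e = heightRaw (vord G) es e

  subgraph : (es : List (Edge n)) → es ⊆ EG → TOGraph n
  subgraph es τ = record
    { vord = vord G ; vord-unique = vord-unique G ; vord-complete = vord-complete G
    ; edges = es ; edges-unique = Unique-resp-⊆ τ (edges-unique G)
    ; edges-canon = All-resp-⊆ τ (edges-canon G) }

  canonical : ∀ {es e} → es ⊆ EG → e ∈ es → Canonical e
  canonical τ e∈ = All.lookup (edges-canon G) (Sublist.lookup τ e∈)

  Position : ℕ → Edge n → Set
  Position = AtEdge EG

  Touches : List (Edge n) → Fin n → Set
  Touches es v = ∃ λ f → f ∈ es × Incident v f

  record Extension (es : List (Edge n)) (F : List (Fin n)) (x y : Fin n) (p len : ℕ) : Set where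
    field
      rest       : List (Fin n)
      positions  : List ℕ
      distinct   : Unique (x ∷ y ∷ rest)
      chain      : Chain EG (x ∷ y ∷ rest) (p ∷ positions)
      increasing : Linked _<_ (p ∷ positions)
      long       : len ≤ length (p ∷ positions)
      avoids     : All (_∉ F) (x ∷ y ∷ rest)
      touches    : All (Touches es) (x ∷ y ∷ rest)

  weaken : ∀ {es F x y p len len′} → len′ ≤ len → Extension es F x y p len → Extension es F x y p len′
  weaken len′≤len ext = record
    { rest = rest ; positions = positions ; distinct = distinct ; chain = chain
    ; increasing = increasing ; long = ≤-trans len′≤len long ; avoids = avoids ; touches = touches }
    where open Extension ext

  single : ∀ {es x y e p} → es ⊆ EG → e ∈ es → Joins e x y → Position p e → Extension es [] x y p 1
  single {x = x} {e = e} τ e∈ j pos = record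
    { rest = [] ; positions = []
    ; distinct = ((λ { refl → joins-irrefl (canonical τ e∈) j }) ∷ []) ∷ [] ∷ []
    ; chain = edgeAt EG pos j , tt ; increasing = [-] ; long = ≤-refl
    ; avoids = (λ ()) ∷ (λ ()) ∷ []
    ; touches = (e , e∈ , joins-incidentˡ j) ∷ (e , e∈ , joins-incidentʳ j) ∷ [] }

  prepend : ∀ {es F x y w e p q len} → x ∉ F → e ∈ es → Joins e x y → Position p e → p < q →
            Extension es (x ∷ F) y w q len → Extension es F x y p (suc len)
  prepend {w = w} {e = e} {q = q} x∉F e∈ j pos p<q ext = record
    { rest = w ∷ rest ; positions = q ∷ positions
    ; distinct = All.map (λ v∉ x≡v → v∉ (here (sym x≡v))) avoids ∷ distinct
    ; chain = edgeAt EG pos j , chain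
    ; increasing = p<q ∷ increasing
    ; long = s≤s long
    ; avoids = x∉F ∷ All.map (λ v∉ v∈F → v∉ (there v∈F)) avoids
    ; touches = (e , e∈ , joins-incidentˡ j) ∷ touches }
    where open Extension ext

  relocate : ∀ {es es′ F x y p len} → es′ ⊆ es → Isolated F es′ →
             Extension es′ [] x y p len → Extension es F x y p len
  relocate es′⊆es isolated ext = record
    { rest = rest ; positions = positions ; distinct = distinct ; chain = chain
    ; increasing = increasing ; long = long
    ; avoids = All.map (λ { (f , f∈ , v∼f) v∈F → isolated v∈F f∈ v∼f }) touches
    ; touches = All.map (λ { (f , f∈ , v∼f) → f , Sublist.lookup es′⊆es f∈ , v∼f }) touches }
    where open Extension ext

  -- If e = xy has height above b + t + 1 and F has t
  -- vertices, then y carries a later edge yw, w ∉ F, w ≠ x, of height above b: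
  -- the t + 1 heights b + 1, …, b + t + 1 are attained by later edges at y
  -- with pairwise distinct other ends, and one of these ends escapes F.
  greedyStep : ∀ {es F t b x y e} → es ⊆ EG → length F ≡ t → e ∈ es → Joins e x y →
    suc (suc t + b) ≤ ht es e →
    ∃ λ w → ∃ λ f → f ∈ es × Joins f y w × w ∉ F × w ≢ x × Precedes es e f × suc b ≤ ht es f
  greedyStep {es} {F} {t} {b} {x} {y} {e} τ |F|≡t e∈ j h-big =
    pick (escape Fin._≟_ F |F|≡t other other-injective)
    where
    below : (u : Fin (suc t)) → suc b + toℕ u < ht es e
    below u = ≤-trans (s≤s (+-monoʳ-≤ (suc b) (≤-pred (Fin.toℕ<n u))))
                      (subst (_≤ ht es e) (cong (λ z → suc (suc z)) (+-comm t b)) h-big)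
    candidate : (u : Fin (suc t)) →
      ∃ λ f → f ∈ es × Incident y f × Precedes es e f × ht es f ≡ suc b + toℕ u
    candidate u = lower-heights (length es) (vord G) es (vord-complete G y) e∈ (joins-incidentʳ j)
                    (suc b + toℕ u) (s≤s z≤n) (below u)
    edge : Fin (suc t) → Edge n
    edge u = proj₁ (candidate u)
    at-y : ∀ u → Incident y (edge u)
    at-y u = proj₁ (proj₂ (proj₂ (candidate u)))
    other : Fin (suc t) → Fin n
    other u = proj₁ (incident-joins (at-y u))
    joins : ∀ u → Joins (edge u) y (other u)
    joins u = proj₂ (incident-joins (at-y u))
    edge∈ : ∀ u → edge u ∈ es
    edge∈ u = proj₁ (proj₂ (candidate u))
    height-of : ∀ u → ht es (edge u) ≡ suc b + toℕ u
    height-of u = proj₂ (proj₂ (proj₂ (proj₂ (candidate u))))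
    other-injective : ∀ {a a′} → other a ≡ other a′ → a ≡ a′
    other-injective {a} {a′} same-end =
      Fin.toℕ-injective (+-cancelˡ-≡ (suc b) _ _
        (trans (sym (height-of a)) (trans (cong (ht es) same-edge) (height-of a′))))
      where
      same-edge : edge a ≡ edge a′
      same-edge = joins-unique (canonical τ (edge∈ a)) (canonical τ (edge∈ a′))
                    (joins a) (subst (Joins (edge a′) y) (sym same-end) (joins a′))
    pick : ∃ (λ u → other u ∉ F) →
      ∃ λ w → ∃ λ f → f ∈ es × Joins f y w × w ∉ F × w ≢ x × Precedes es e f × suc b ≤ ht es f
    pick (u , w∉F) = other u , edge u , edge∈ u , joins u , w∉F , w≢x , later ,
      subst (suc b ≤_) (sym (height-of u)) (m≤m+n (suc b) (toℕ u))
      where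
      later : Precedes es e (edge u)
      later = proj₁ (proj₂ (proj₂ (proj₂ (candidate u))))
      w≢x : other u ≢ x
      w≢x w≡x = Precedes-irrefl (Unique-resp-⊆ τ (edges-unique G)) (subst (Precedes es e) (sym e≡f) later)
        where
        e≡f : e ≡ edge u
        e≡f = joins-unique (canonical τ e∈) (canonical τ (edge∈ u)) j
                (joins-sym (subst (Joins (edge u) y) w≡x (joins u)))

  Reach : ℕ → Set
  Reach k = ∀ {es x y e p} → es ⊆ EG → e ∈ es → Joins e x y → Position p e →
            k * D ≤ ht es e ∸ 1 → Extension es [] x y p (s * k + 1)

  -- Closing a round: delete the s vertices F used in it.  The current edge
  -- survives, loses at most g in height, and the continuation found in the
  -- smaller graph stays away from F.
  afterDeletion : ∀ {k es F x y e p} → Reach k → es ⊆ EG → length F ≡ s → Unique F →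
    x ∉ F → y ∉ F → e ∈ es → Joins e x y → Position p e →
    suc (k * D + g) ≤ ht es e → Extension es F x y p (s * k + 1)
  afterDeletion {k} {es} {F} {x} {y} {e} reach τ |F|≡s F-unique x∉F y∉F e∈ j pos h-big =
    relocate es′⊆es isolated (reach (⊆-trans es′⊆es τ) e∈es′ j pos still-high)
    where
    H = subgraph es τ
    es′ = delEdges H F
    es′⊆es : es′ ⊆ es
    es′⊆es = filter-⊆ _ es
    isolated : Isolated F es′
    isolated u∈F f∈ (inj₁ refl) = proj₁ (proj₂ (∈-filter⁻ _ {xs = es} f∈)) u∈F
    isolated u∈F f∈ (inj₂ refl) = proj₂ (proj₂ (∈-filter⁻ _ {xs = es} f∈)) u∈F
    survives : ∀ {f} → f ∈ es → Joins f x y → f ∈ es′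
    survives f∈ (inj₁ refl) = ∈-filter⁺ _ f∈ (x∉F , y∉F)
    survives f∈ (inj₂ refl) = ∈-filter⁺ _ f∈ (y∉F , x∉F)
    e∈es′ : e ∈ es′
    e∈es′ = survives e∈ j
    same-height : heightDel H F e ≡ ht es′ e
    same-height = cong (λ rs → rowIndex rs e)
                    (rows-skip-isolated F (length es′) (vord G) es′ isolated)
    dropped : ht es e ≤ ht es′ e + g
    dropped = subst (λ h′ → ht es e ≤ h′ + g) same-height
                (drop-bound (ht es e) (heightDel H F e) g (bounded H F F-unique |F|≡s e e∈es′))
    still-high : k * D ≤ ht es′ e ∸ 1
    still-high = ≤∸1-of-< (+-cancelʳ-< g (k * D) (ht es′ e) (≤-trans h-big dropped))

  -- A round in progress: t of its s steps are done, the vertices F before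
  -- the current edge xy are to be deleted at the end of the round, and the
  -- remaining m steps together with the later rounds are still affordable.
  segment : ∀ {k} → Reach k → ∀ t m {es F x y e p} → t + m ≡ s → es ⊆ EG →
    length F ≡ t → Unique F → x ∉ F → y ∉ F → e ∈ es → Joins e x y → Position p e →
    suc (rangeSum t m + (k * D + g)) ≤ ht es e → Extension es F x y p (m + s * k + 1)
  segment reach t zero t+0≡s τ |F|≡t =
    afterDeletion reach τ (trans |F|≡t (trans (sym (+-identityʳ t)) t+0≡s))
  segment {k} reach t (suc m) {es} {F} {x} {y} {e} {p} t+m≡s τ |F|≡t F-unique x∉F y∉F e∈ j pos h-big =
    step (greedyStep τ |F|≡t e∈ j (subst (_≤ ht es e) (cong suc (+-assoc (suc t) (rangeSum (suc t) m) _)) h-big))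
    where
    step : (∃ λ w → ∃ λ f → f ∈ es × Joins f y w × w ∉ F × w ≢ x × Precedes es e f ×
              suc (rangeSum (suc t) m + (k * D + g)) ≤ ht es f) →
           Extension es F x y p (suc m + s * k + 1)
    step (w , f , f∈ , jf , w∉F , w≢x , e≺f , f-high)
      with later-position EG (edges-unique G) pos (Precedes-resp-⊆ τ e≺f)
    ... | q , p<q , pos-f =
      prepend x∉F e∈ j pos p<q
        (segment reach (suc t) m (trans (sym (+-suc t m)) t+m≡s) τ (cong suc |F|≡t)
          (¬Any⇒All¬ F x∉F ∷ F-unique) y∉xF w∉xF f∈ jf pos-f f-high)
      where
      y∉xF : y ∉ x ∷ F
      y∉xF (here y≡x) = joins-irrefl (canonical τ e∈) (subst (Joins e x) y≡x j)
      y∉xF (there y∈F) = y∉F y∈F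
      w∉xF : w ∉ x ∷ F
      w∉xF (here w≡x) = w≢x w≡x
      w∉xF (there w∈F) = w∉F w∈F

  reach-zero : Reach 0
  reach-zero τ e∈ j pos _ = weaken (≤-reflexive (cong (_+ 1) (*-zeroʳ s))) (single τ e∈ j pos)

  -- A height above (k+1)·D pays for a full round of s steps and leaves
  -- enough for k further rounds.
  reach-suc : ∀ {k} → Reach k → Reach (suc k)
  reach-suc {k} reach {es} {e = e} τ e∈ j pos high =
    weaken (≤-reflexive (cong (_+ 1) (*-suc s k)))
      (segment reach 0 s refl τ refl [] (λ ()) (λ ()) e∈ j pos round-affordable)
    where
    cost : suc k * D ≡ rangeSum 0 s + (k * D + g)
    cost = begin
      (s + 1) C 2 + g + k * D     ≡⟨ +-assoc ((s + 1) C 2) g (k * D) ⟩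
      (s + 1) C 2 + (g + k * D)   ≡⟨ cong₂ _+_ (sym (rangeSum-round s)) (+-comm g (k * D)) ⟩
      rangeSum 0 s + (k * D + g)  ∎
      where open ≡-Reasoning
    round-affordable : suc (rangeSum 0 s + (k * D + g)) ≤ ht es e
    round-affordable = <-of-≤∸1 (≤-trans (rangeSum-pos 0 1≤s) (m≤m+n _ _)) (subst (_≤ ht es e ∸ 1) cost high)

  reach : ∀ k → Reach k
  reach zero    = reach-zero
  reach (suc k) = reach-suc (reach k)

lemma2p5 : (n : ℕ) (G : TOGraph n) (x₀ x₁ : Fin n) (e : Edge n) (r s g : ℕ) →
    e ∈ edges G → (e ≡ (x₀ , x₁) ⊎ e ≡ (x₁ , x₀)) → height G e ≡ r →
    1 ≤ s → s + 2 ≤ n → IsGMax n s g →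
    Σ (List (Fin n)) λ rest → Σ ℕ λ ℓ →
      MonotonePath G (x₀ ∷ x₁ ∷ rest) ℓ × s * kVal r s g + 1 ≤ ℓ
lemma2p5 n G x₀ x₁ e r zero g _ _ _ () _ _
lemma2p5 n G x₀ x₁ e .(height G e) (suc s′) g e∈ j refl _ _ gmax =
  rest , length (p ∷ positions) , (distinct , p ∷ positions , chain , increasing , refl) , long
  where
  open Construction G (suc s′) g (s≤s z≤n) (proj₁ gmax)
  position : ∃ λ p → Position p e
  position = ∈⇒AtEdge e∈
  p = proj₁ position
  k-fits : kVal (height G e) (suc s′) g * D ≤ height G e ∸ 1
  k-fits = m/n*n≤m (height G e ∸ 1) D {{denom-nz s′ g}}
  open Extension (reach (kVal (height G e) (suc s′) g) ⊆-refl e∈ j (proj₂ position) k-fits)
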